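{- For every continuation variable $\alpha$, every term $r\in\mathrm{SN}$ and every finite sequence $u_1,\dots,u_n$ ($n\ge0$) of terms in $\mathrm{SN}$, we have $(\mathtt{throw}\,\alpha\,r)\,u_1\cdots u_n\in\mathrm{SN}$.
   Context: Calculus $\lambda^{::}_{\mathtt{catch}}$. Terms: $t,r,s ::= x \mid () \mid \mathtt{nil} \mid (::) \mid \mathtt{lrec} \mid \lambda x.r \mid t\,s \mid \mathtt{catch}\,\alpha\,t \mid \mathtt{throw}\,\alpha\,t$ ($x$ variables, $\alpha,\beta$ continuation variables; application left-associative; $t::r$ abbreviates $(::)\,t\,r$). $\mathrm{FCV}$ = free continuation variables, $t[x:=r]$ capture-avoiding substitution. Values: $v,w ::= x \mid () \mid \mathtt{nil} \mid (::) \mid (::)\,v \mid (::)\,v\,w \mid \mathtt{lrec} \mid \mathtt{lrec}\,v \mid \mathtt{lrec}\,v\,w \mid \lambda x.r$. Contexts $E ::= \Box\,t \mid v\,\Box \mid \mathtt{throw}\,\alpha\,\Box$. Reduction $\to$ is the compatible closure of: $(\lambda x.t)\,v\to t[x:=v]$; $E[\mathtt{throw}\,\alpha\,t]\to\mathtt{throw}\,\alpha\,t$; $\mathtt{catch}\,\alpha\,(\mathtt{throw}\,\alpha\,t)\to\mathtt{catch}\,\alpha\,t$; $\mathtt{catch}\,\alpha\,(\mathtt{throw}\,\beta\,v)\to\mathtt{throw}\,\beta\,v$ if $\alpha\notin\{\beta\}\cup\mathrm{FCV}(v)$; $\mathtt{catch}\,\alpha\,v\to v$ if $\alpha\notin\mathrm{FCV}(v)$;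 $\mathtt{lrec}\,v_r\,v_s\,\mathtt{nil}\to v_r$; $\mathtt{lrec}\,v_r\,v_s\,(v_h::v_t)\to v_s\,v_h\,v_t\,(\mathtt{lrec}\,v_r\,v_s\,v_t)$. $\mathrm{SN}$ is the set of terms $t$ for which the lengths of all reduction sequences starting at $t$ are bounded. -}

module Defs where

-- Calculus λ^{::}_{catch}, with de Bruijn indices for both term variables
-- and continuation variables (catch α t binds the continuation variable 0).

open import Data.Nat using (ℕ; zero; suc; _≤_)
open import Data.List using (List; foldl)
open import Data.Product using (Σ)

data Tm : Set where
  var   : ℕ → Tm
  unit  : Tm
  nil   : Tm
  cons  : Tm
  lrec  : Tm
  lam   : Tm → Tm
  app   : Tm → Tm → Tm
  catch : Tm → Tm
  throw : ℕ → Tm → Tm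

ext : (ℕ → ℕ) → ℕ → ℕ
ext ρ zero    = zero
ext ρ (suc n) = suc (ρ n)

ren : (ℕ → ℕ) → Tm → Tm
ren ρ (var x)     = var (ρ x)
ren ρ unit        = unit
ren ρ nil         = nil
ren ρ cons        = cons
ren ρ lrec        = lrec
ren ρ (lam t)     = lam (ren (ext ρ) t)
ren ρ (app t s)   = app (ren ρ t) (ren ρ s)
ren ρ (catch t)   = catch (ren ρ t)
ren ρ (throw a t) = throw a (ren ρ t)

cren : (ℕ → ℕ) → Tm → Tm
cren ρ (var x)     = var x
cren ρ unit        = unit
cren ρ nil         = nil
cren ρ cons        = cons
cren ρ lrec        = lrec
cren ρ (lam t)     = lam (cren ρ t)
cren ρ (app t s)   = app (cren ρ t) (cren ρ s)
cren ρ (catch t)   = catch (cren (ext ρ) t)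
cren ρ (throw a t) = throw (ρ a) (cren ρ t)

exts : (ℕ → Tm) → ℕ → Tm
exts σ zero    = var zero
exts σ (suc n) = ren suc (σ n)

sub : (ℕ → Tm) → Tm → Tm
sub σ (var x)     = σ x
sub σ unit        = unit
sub σ nil         = nil
sub σ cons        = cons
sub σ lrec        = lrec
sub σ (lam t)     = lam (sub (exts σ) t)
sub σ (app t s)   = app (sub σ t) (sub σ s)
sub σ (catch t)   = catch (sub (λ n → cren suc (σ n)) t)
sub σ (throw a t) = throw a (sub σ t)

sub0 : Tm → ℕ → Tm
sub0 v zero    = v
sub0 v (suc n) = var n

_[0:=_] : Tm → Tm → Tm
t [0:= v ] = sub (sub0 v) t

_∷ₜ_ : Tm → Tm → Tm
t ∷ₜ r = app (app cons t) r

data Value : Tm → Set where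
  v-var    : ∀ x → Value (var x)
  v-unit   : Value unit
  v-nil    : Value nil
  v-cons0  : Value cons
  v-cons1  : ∀ {v} → Value v → Value (app cons v)
  v-cons2  : ∀ {v w} → Value v → Value w → Value (app (app cons v) w)
  v-lrec0  : Value lrec
  v-lrec1  : ∀ {v} → Value v → Value (app lrec v)
  v-lrec2  : ∀ {v w} → Value v → Value w → Value (app (app lrec v) w)
  v-lam    : ∀ t → Value (lam t)

-- One-step reduction: compatible closure of the rules.
-- α ∉ FCV(v) for the bound α (= index 0) is expressed by the body being
-- cren suc v for some v (v then is the term with α removed / indices lowered).
infix 4 _⟶_
data _⟶_ : Tm → Tm → Set where
  β-lam     : ∀ {t v} → Value v → app (lam t) v ⟶ t [0:= v ]
  throw-appL : ∀ {a t s} → app (throw a t) s ⟶ throw a t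
  throw-appR : ∀ {v a t} → Value v → app v (throw a t) ⟶ throw a t
  throw-throw : ∀ {b a t} → throw b (throw a t) ⟶ throw a t
  catch-throw-same : ∀ {t} → catch (throw zero t) ⟶ catch t
  catch-throw-other : ∀ {b v} → Value v →
    catch (throw (suc b) (cren suc v)) ⟶ throw b v
  catch-val : ∀ {v} → Value v → catch (cren suc v) ⟶ v
  lrec-nil  : ∀ {vr vs} → Value vr → Value vs →
    app (app (app lrec vr) vs) nil ⟶ vr
  lrec-cons : ∀ {vr vs vh vt} → Value vr → Value vs → Value vh → Value vt →
    app (app (app lrec vr) vs) (vh ∷ₜ vt)
      ⟶ app (app (app vs vh) vt) (app (app (app lrec vr) vs) vt)
  ξ-lam   : ∀ {t t'} → t ⟶ t' → lam t ⟶ lam t'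
  ξ-appL  : ∀ {t t' s} → t ⟶ t' → app t s ⟶ app t' s
  ξ-appR  : ∀ {t s s'} → s ⟶ s' → app t s ⟶ app t s'
  ξ-catch : ∀ {t t'} → t ⟶ t' → catch t ⟶ catch t'
  ξ-throw : ∀ {a t t'} → t ⟶ t' → throw a t ⟶ throw a t'

data Steps : ℕ → Tm → Tm → Set where
  done : ∀ {t} → Steps zero t t
  step : ∀ {n t t' t''} → t ⟶ t' → Steps n t' t'' → Steps (suc n) t t''

SN : Tm → Set
SN t = Σ ℕ (λ b → ∀ k t' → Steps k t t' → k ≤ b)

apps : Tm → List Tm → Tm
apps t us = foldl app t us

-- A term (throw α r) u₁ ⋯ uₙ can only reduce inside r, inside some uᵢ, by
-- erasing its first argument (throw-appL), or by throw-throw at the head.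
-- Weighting a spine by 1 + (weight of the head) + (bound of the argument) at
-- each application makes every such step strictly decrease the weight, and a
-- weight that decreases along every step bounds the length of every reduction
-- sequence. The head throw α r is weighted 1 + (bound of r); after a
-- throw-throw step it becomes the reduct r = throw β r', weighted by the
-- bound of r itself.
module Submission where

open import Defs
open import Data.Nat using (ℕ; zero; suc; _+_; _≤_; _<_; z≤n; s≤s)
open import Data.Nat.Properties using (≤-trans; ≤-pred; +-monoˡ-<; +-monoʳ-<; m≤m+n; n<1+n)
open import Data.List using (List; []; _∷_)
open import Data.List.Relation.Unary.All using (All; []; _∷_)
open import Data.Product using (Σ; _,_; _×_)
open import Data.Empty using (⊥-elim)
open import Relation.Nullary using (¬_)

BoundedBy : ℕ → Tm → Set
BoundedBy n t = ∀ k t' → Steps k t t' → k ≤ n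

Decreasing : (ℕ → Tm → Set) → Set
Decreasing P = ∀ {n t t'} → P n t → t ⟶ t' → Σ ℕ λ n' → n' < n × P n' t'

decreasing⇒bounded : ∀ {P} → Decreasing P → ∀ {n t} → P n t → BoundedBy n t
decreasing⇒bounded dec p _ _ done = z≤n
decreasing⇒bounded dec p _ _ (step s st) with dec p s
... | n' , n'<n , p' = ≤-trans (s≤s (decreasing⇒bounded dec p' _ _ st)) n'<n

boundedBy-decreasing : Decreasing BoundedBy
boundedBy-decreasing {zero} bt s with bt 1 _ (step s done)
... | ()
boundedBy-decreasing {suc n} bt s = n , n<1+n n , λ k t' st → ≤-pred (bt (suc k) t' (step s st))

data ThrowSpine : ℕ → Tm → Set where
  throw-sn      : ∀ {n a r} → BoundedBy n r → ThrowSpine (suc n) (throw a r)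
  throw-bounded : ∀ {n a r} → BoundedBy n (throw a r) → ThrowSpine n (throw a r)
  app           : ∀ {n m t u} → ThrowSpine n t → BoundedBy m u →
                  ThrowSpine (suc (n + m)) (app t u)

throwSpine-not-value : ∀ {n t} → ThrowSpine n t → ¬ Value t
throwSpine-not-value (app () _) (v-cons1 _)
throwSpine-not-value (app (app () _) _) (v-cons2 _ _)
throwSpine-not-value (app () _) (v-lrec1 _)
throwSpine-not-value (app (app () _) _) (v-lrec2 _ _)

throwSpine-decreasing : Decreasing ThrowSpine
throwSpine-decreasing (throw-sn {n} br) throw-throw = n , n<1+n n , throw-bounded br
throwSpine-decreasing (throw-sn br) (ξ-throw s) with boundedBy-decreasing br s
... | n' , n'<n , br' = suc n' , s≤s n'<n , throw-sn br'
throwSpine-decreasing (throw-bounded bt) s@throw-throw with boundedBy-decreasing bt s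
... | n' , n'<n , bt' = n' , n'<n , throw-bounded bt'
throwSpine-decreasing (throw-bounded bt) s@(ξ-throw _) with boundedBy-decreasing bt s
... | n' , n'<n , bt' = n' , n'<n , throw-bounded bt'
throwSpine-decreasing (app {n} {m} head _) throw-appL = n , s≤s (m≤m+n n m) , head
throwSpine-decreasing (app sp _) (throw-appR v) = ⊥-elim (throwSpine-not-value sp v)
throwSpine-decreasing (app () _) (β-lam _)
throwSpine-decreasing (app (app (app () _) _) _) (lrec-nil _ _)
throwSpine-decreasing (app (app (app () _) _) _) (lrec-cons _ _ _ _)
throwSpine-decreasing (app {m = m} sp bu) (ξ-appL s) with throwSpine-decreasing sp s
... | n' , n'<n , sp' = suc (n' + m) , s≤s (+-monoˡ-< m n'<n) , app sp' bu
throwSpine-decreasing (app {n} sp bu) (ξ-appR s) with boundedBy-decreasing bu s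
... | m' , m'<m , bu' = suc (n + m') , s≤s (+-monoʳ-< n m'<m) , app sp bu'

throwSpine-apps : ∀ {n t} us → ThrowSpine n t → All SN us → Σ ℕ λ m → ThrowSpine m (apps t us)
throwSpine-apps [] sp [] = _ , sp
throwSpine-apps (u ∷ us) sp ((_ , bu) ∷ sn-us) = throwSpine-apps us (app sp bu) sn-us

lemma4p9 : (α : ℕ) (r : Tm) (us : List Tm) →
    SN r → All SN us → SN (apps (throw α r) us)
lemma4p9 α r us (_ , br) sn-us with throwSpine-apps us (throw-sn {a = α} br) sn-us
... | m , sp = m , decreasing⇒bounded throwSpine-decreasing sp
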